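{- There exist $\alpha,\beta,\gamma\in Sen(L)$, a truth assignment $M$ and a choice function $f$ of the form $f=\min_<$ for a regular total ordering $<$ of $Sen(L)$ which is not $\neg$-decreasing, such that $$\langle M,f\rangle\not\models_s\alpha\circ(\beta|\gamma)\leftrightarrow(\alpha\circ\beta)|(\alpha\circ\gamma).$$
   Context: $L$ is the propositional language with atoms $p_0,p_1,\ldots$ and connectives $\neg,\wedge$ (others defined); $L_s$ adds a primitive binary connective $|$, and $\varphi\circ\psi$ abbreviates $\neg(\neg\varphi|\neg\psi)$. $\sim$ is classical equivalence on $Sen(L)$, $[\alpha]=\{\beta:\beta\sim\alpha\}$. A total ordering $<$ of $Sen(L)$ is regular if $\alpha\not\sim\beta$ and $\alpha<\beta$ imply $\alpha'<\beta'$ for all $\alpha'\in[\alpha],\beta'\in[\beta]$; it is $\neg$-decreasing if for all $\alpha\not\sim\beta$: $\alpha<\beta\iff\neg\beta<\neg\alpha$. A choice function $f$ for $L$ picks $f(\alpha,\beta)\in\{\alpha,\beta\}$ for each pair of $L$-sentences; it induces $\overline f:Sen(L_s)\to Sen(L)$: identity on $Sen(L)$, commuting with $\neg,\wedge$, and $\overline f(\varphi|\psi)=f(\overline f(\varphi),\overline f(\psi))$. For a truth assignment $M$, $\langle M,f\rangle\models_s\varphi$ iff $M\models\overline f(\varphi)$. -}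

module Defs where

open import Data.Nat using (ℕ)
open import Data.Bool using (Bool; true; false; not; _∧_)
open import Data.Product using (_×_; Σ; ∃; _,_)
open import Relation.Binary.PropositionalEquality using (_≡_)
open import Relation.Binary.Definitions using (Tri; tri<; tri≈; tri>)
open import Relation.Binary.Structures using (IsStrictTotalOrder)
open import Relation.Binary.Core using (Rel)
open import Relation.Nullary using (¬_)
open import Level using (0ℓ)

data Sen : Set where
  atom : ℕ → Sen
  neg  : Sen → Sen
  conj : Sen → Sen → Sen

data SenS : Set where
  atom : ℕ → SenS
  neg  : SenS → SenS
  conj : SenS → SenS → SenS
  bar  : SenS → SenS → SenS

Assignment : Set
Assignment = ℕ → Bool

eval : Assignment → Sen → Bool
eval M (atom i)   = M i
eval M (neg a)    = not (eval M a)
eval M (conj a b) = eval M a ∧ eval M b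

_⊨_ : Assignment → Sen → Set
M ⊨ a = eval M a ≡ true

_∼_ : Sen → Sen → Set
a ∼ b = ∀ (M : Assignment) → eval M a ≡ eval M b

ChoiceFn : Set
ChoiceFn = Sen → Sen → Sen

IsChoiceFn : ChoiceFn → Set
IsChoiceFn f = ∀ a b → (f a b ≡ a) Data.Sum.⊎ (f a b ≡ b)
  where import Data.Sum

fbar : ChoiceFn → SenS → Sen
fbar f (atom i)   = atom i
fbar f (neg φ)    = neg (fbar f φ)
fbar f (conj φ ψ) = conj (fbar f φ) (fbar f ψ)
fbar f (bar φ ψ)  = f (fbar f φ) (fbar f ψ)

_,_⊨s_ : Assignment → ChoiceFn → SenS → Set
M , f ⊨s φ = M ⊨ fbar f φ

_∘s_ : SenS → SenS → SenS
φ ∘s ψ = neg (bar (neg φ) (neg ψ))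

_⇒s_ : SenS → SenS → SenS
φ ⇒s ψ = neg (conj φ (neg ψ))

_⇔s_ : SenS → SenS → SenS
φ ⇔s ψ = conj (φ ⇒s ψ) (ψ ⇒s φ)

emb : Sen → SenS
emb (atom i)   = atom i
emb (neg a)    = neg (emb a)
emb (conj a b) = conj (emb a) (emb b)

Regular : Rel Sen 0ℓ → Set
Regular _<_ = ∀ a b → ¬ (a ∼ b) → a < b → ∀ a' b' → a' ∼ a → b' ∼ b → a' < b'

NegDecreasing : Rel Sen 0ℓ → Set
NegDecreasing _<_ = ∀ a b → ¬ (a ∼ b) → (a < b → neg b < neg a) × (neg b < neg a → a < b)

minOf : ∀ {_<_ : Rel Sen 0ℓ} → IsStrictTotalOrder _≡_ _<_ → ChoiceFn
minOf sto a b with IsStrictTotalOrder.compare sto a b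
... | tri< _ _ _ = a
... | tri≈ _ _ _ = a
... | tri> _ _ _ = b

-- The order ≺ compares two sentences first by their truth tables on the
-- atoms p₀ … p_{k-1}, for a k covering both, read as binary words with the
-- tautologies put first, and only then by their Polish notation. The table
-- over k + 1 atoms of a sentence not mentioning p_k is its table over k atoms
-- written twice, and writing both words twice does not change how they
-- compare; so the comparison does not depend on k, which gives transitivity,
-- and for inequivalent sentences it depends only on their classes, which is
-- regularity. Putting the tautologies first breaks ¬-decreasingness:
-- ⊤ ≺ p₀ and ¬⊤ ≺ ¬p₀. With α = ⊤, β = ⊥, γ = p₀ and all atoms false, the
-- left side of the biconditional evaluates to false and the right side to true.

module Submission where

open import Defs
open import Data.Product using (Σ; _×_; _,_; proj₁)
open import Relation.Binary.PropositionalEquality using (_≡_)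
open import Relation.Binary.Core using (Rel)
open import Relation.Binary.Structures using (IsStrictTotalOrder)
open import Relation.Nullary using (¬_)
open import Level using (0ℓ)

open import Data.Bool using (Bool; true; false; not; _∧_)
open import Data.Bool.Properties using (∧-idem; ∧-assoc)
open import Data.Empty using (⊥-elim)
open import Data.List using (List; []; _∷_; _++_; [_]; length; map)
open import Data.Bool.ListAction using (and)
open import Data.List.Properties using (map-++; map-∘; map-cong; length-map; map-injective; ∷-injectiveˡ; ∷-injectiveʳ; ++-assoc)
open import Data.List.Membership.Propositional using (_∈_)
open import Data.List.Membership.Propositional.Properties using (∈-map⁺; ∈-++⁺ˡ; ∈-++⁺ʳ)
open import Data.List.Relation.Unary.Any using (here; there)
open import Data.List.Relation.Binary.Lex.Strict using (Lex-<; base; this; next; <-isStrictTotalOrder)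
open import Data.List.Relation.Binary.Pointwise using (Pointwise; Pointwise-≡⇒≡; ≡⇒Pointwise-≡)
open import Data.Nat using (ℕ; zero; suc; _<_; _≤_; _⊔_; _≟_; _≤′_; ≤′-reflexive; ≤′-step; z<s)
import Data.Nat.Properties as ℕ
open import Data.Sum using (_⊎_; inj₁; inj₂)
import Data.Sum as Sum
import Data.Product as Product
open import Function using (_⇔_; mk⇔; Equivalence; _∘_)
import Function.Properties.Equivalence as ⇔
open import Relation.Binary.Definitions using (Tri; tri<; tri≈; tri>)
open import Relation.Binary.PropositionalEquality using (refl; sym; trans; cong; cong₂; subst₂; isEquivalence; module ≡-Reasoning)
open import Relation.Binary.Structures.Biased using (isStrictTotalOrderᶜ)
open import Relation.Nullary using (yes; no)

module LexAppend {A : Set} {_≺_ : Rel A 0ℓ} where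

  infix 4 _<ₗ_
  _<ₗ_ : Rel (List A) 0ℓ
  _<ₗ_ = Lex-< _≡_ _≺_

  <ₗ-++⁺ : ∀ p q {u v} → length p ≡ length q →
           p <ₗ q ⊎ (p ≡ q × u <ₗ v) → p ++ u <ₗ q ++ v
  <ₗ-++⁺ []      []      _  (inj₁ (base ()))
  <ₗ-++⁺ []      []      _  (inj₂ (_ , u<v))            = u<v
  <ₗ-++⁺ (x ∷ p) (y ∷ q) _  (inj₁ (this x≺y))           = this x≺y
  <ₗ-++⁺ (x ∷ p) (y ∷ q) eq (inj₁ (next refl p<q))      = next refl (<ₗ-++⁺ p q (ℕ.suc-injective eq) (inj₁ p<q))
  <ₗ-++⁺ (x ∷ p) (y ∷ q) eq (inj₂ (refl , u<v))         = next refl (<ₗ-++⁺ p q (ℕ.suc-injective eq) (inj₂ (refl , u<v)))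

  <ₗ-++⁻ : ∀ p q {u v} → length p ≡ length q →
           p ++ u <ₗ q ++ v → p <ₗ q ⊎ (p ≡ q × u <ₗ v)
  <ₗ-++⁻ []      []      _  u<v              = inj₂ (refl , u<v)
  <ₗ-++⁻ (x ∷ p) (y ∷ q) _  (this x≺y)       = inj₁ (this x≺y)
  <ₗ-++⁻ (x ∷ p) (y ∷ q) eq (next refl lt) with <ₗ-++⁻ p q (ℕ.suc-injective eq) lt
  ... | inj₁ p<q          = inj₁ (next refl p<q)
  ... | inj₂ (refl , u<v) = inj₂ (refl , u<v)

  <ₗ-++-cong : ∀ p q {u v u′ v′} → length p ≡ length q →
               (u <ₗ v ⇔ u′ <ₗ v′) → (p ++ u <ₗ q ++ v) ⇔ (p ++ u′ <ₗ q ++ v′)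
  <ₗ-++-cong p q eq u⇔u′ = mk⇔
    (λ lt → <ₗ-++⁺ p q eq (Sum.map₂ (Product.map₂ (Equivalence.to u⇔u′)) (<ₗ-++⁻ p q eq lt)))
    (λ lt → <ₗ-++⁺ p q eq (Sum.map₂ (Product.map₂ (Equivalence.from u⇔u′)) (<ₗ-++⁻ p q eq lt)))

  <ₗ-++-duplicate : ∀ t s {u v} → length t ≡ length s →
                    (t ++ t ++ u <ₗ s ++ s ++ v) ⇔ (t ++ u <ₗ s ++ v)
  <ₗ-++-duplicate t s eq = mk⇔ to from
    where
    to : t ++ t ++ _ <ₗ s ++ s ++ _ → t ++ _ <ₗ s ++ _
    to lt with <ₗ-++⁻ t s eq lt
    ... | inj₁ t<s        = <ₗ-++⁺ t s eq (inj₁ t<s)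
    ... | inj₂ (refl , h) = h
    from : t ++ _ <ₗ s ++ _ → t ++ t ++ _ <ₗ s ++ s ++ _
    from lt with <ₗ-++⁻ t s eq lt
    ... | inj₁ t<s        = <ₗ-++⁺ t s eq (inj₁ t<s)
    ... | inj₂ (refl , _) = <ₗ-++⁺ t t eq (inj₂ (refl , lt))

open LexAppend {A = ℕ} {_≺_ = _<_}

atomBound : Sen → ℕ
atomBound (atom i)   = suc i
atomBound (neg a)    = atomBound a
atomBound (conj a b) = atomBound a ⊔ atomBound b

AgreeBelow : ℕ → Assignment → Assignment → Set
AgreeBelow n ρ σ = ∀ {i} → i < n → ρ i ≡ σ i

AgreeBelow-weaken : ∀ {m n ρ σ} → m ≤ n → AgreeBelow n ρ σ → AgreeBelow m ρ σ
AgreeBelow-weaken m≤n agree i<m = agree (ℕ.<-≤-trans i<m m≤n)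

eval-agree : ∀ a {ρ σ} → AgreeBelow (atomBound a) ρ σ → eval ρ a ≡ eval σ a
eval-agree (atom i)   agree = agree ℕ.≤-refl
eval-agree (neg a)    agree = cong not (eval-agree a agree)
eval-agree (conj a b) agree = cong₂ _∧_
  (eval-agree a (AgreeBelow-weaken (ℕ.m≤m⊔n (atomBound a) (atomBound b)) agree))
  (eval-agree b (AgreeBelow-weaken (ℕ.m≤n⊔m (atomBound a) (atomBound b)) agree))

update : Assignment → ℕ → Bool → Assignment
update ρ k v i with i ≟ k
... | yes _ = v
... | no  _ = ρ i

update-agree : ∀ ρ k v → AgreeBelow k (update ρ k v) ρ
update-agree ρ k v {i} i<k with i ≟ k
... | yes refl = ⊥-elim (ℕ.<-irrefl refl i<k)
... | no  _    = refl

eval-update : ∀ a {ρ k v} → atomBound a ≤ k → eval (update ρ k v) a ≡ eval ρ a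
eval-update a {ρ} {k} {v} a≤k = eval-agree a (AgreeBelow-weaken a≤k (update-agree ρ k v))

-- The i-th assignment gives p_j the j-th binary digit of i for j < k, and
-- makes every other atom false.
assignments : ℕ → List Assignment
assignments zero    = (λ _ → false) ∷ []
assignments (suc k) = map (λ ρ → update ρ k false) (assignments k) ++ map (λ ρ → update ρ k true) (assignments k)

restrict : ℕ → Assignment → Assignment
restrict zero    M = λ _ → false
restrict (suc k) M = update (restrict k M) k (M k)

restrict-∈ : ∀ k M → restrict k M ∈ assignments k
restrict-∈ zero    M = here refl
restrict-∈ (suc k) M with M k
... | false = ∈-++⁺ˡ (∈-map⁺ _ (restrict-∈ k M))
... | true  = ∈-++⁺ʳ _ (∈-map⁺ _ (restrict-∈ k M))

restrict-agree : ∀ k M → AgreeBelow k (restrict k M) M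
restrict-agree zero    M ()
restrict-agree (suc k) M {i} i<1+k with i ≟ k
... | yes refl = refl
... | no  i≢k  = restrict-agree k M (ℕ.≤∧≢⇒< (ℕ.≤-pred i<1+k) i≢k)

table : ℕ → Sen → List Bool
table k a = map (λ ρ → eval ρ a) (assignments k)

length-table : ∀ k a b → length (table k a) ≡ length (table k b)
length-table k a b = trans (length-map _ (assignments k)) (sym (length-map _ (assignments k)))

table-cong : ∀ k a b → a ∼ b → table k a ≡ table k b
table-cong k a b a∼b = map-cong a∼b (assignments k)

table-suc : ∀ {k} a → atomBound a ≤ k → table (suc k) a ≡ table k a ++ table k a
table-suc {k} a a≤k = trans (map-++ _ (map (λ ρ → update ρ k false) as) _)
                            (cong₂ _++_ (unchanged false) (unchanged true))
  where
  as = assignments k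
  unchanged : ∀ v → map (λ ρ → eval ρ a) (map (λ ρ → update ρ k v) as) ≡ table k a
  unchanged v = trans (sym (map-∘ as)) (map-cong (λ ρ → eval-update a a≤k) as)

map-≡⁻ : ∀ {A B : Set} {f g : A → B} {xs x} → map f xs ≡ map g xs → x ∈ xs → f x ≡ g x
map-≡⁻ {xs = _ ∷ _} eq (here refl) = ∷-injectiveˡ eq
map-≡⁻ {xs = _ ∷ _} eq (there x∈) = map-≡⁻ (∷-injectiveʳ eq) x∈

table-injective : ∀ {k} a b → atomBound a ≤ k → atomBound b ≤ k → table k a ≡ table k b → a ∼ b
table-injective {k} a b a≤k b≤k eq M = begin
  eval M a               ≡⟨ eval-agree a (AgreeBelow-weaken a≤k (λ i<k → sym (restrict-agree k M i<k))) ⟩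
  eval (restrict k M) a  ≡⟨ map-≡⁻ eq (restrict-∈ k M) ⟩
  eval (restrict k M) b  ≡⟨ eval-agree b (AgreeBelow-weaken b≤k (restrict-agree k M)) ⟩
  eval M b               ∎
  where open ≡-Reasoning

and-++ : ∀ t u → and (t ++ u) ≡ and t ∧ and u
and-++ []      u = refl
and-++ (x ∷ t) u = trans (cong (x ∧_) (and-++ t u)) (sym (∧-assoc x (and t) (and u)))

bit : Bool → ℕ
bit false = 0
bit true  = 1

bit-injective : ∀ {x y} → bit x ≡ bit y → x ≡ y
bit-injective {false} {false} _ = refl
bit-injective {true}  {true}  _ = refl

flag : List Bool → ℕ
flag t = bit (not (and t))

code : List Bool → List ℕ
code t = flag t ∷ map bit t

length-code-table : ∀ k a b → length (code (table k a)) ≡ length (code (table k b))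
length-code-table k a b =
  cong suc (trans (length-map bit (table k a)) (trans (length-table k a b) (sym (length-map bit (table k b)))))

code-injective : ∀ {t u} → code t ≡ code u → t ≡ u
code-injective eq = map-injective bit-injective (∷-injectiveʳ eq)

code-++-self : ∀ t → code (t ++ t) ≡ flag t ∷ map bit t ++ map bit t
code-++-self t = cong₂ _∷_ (cong (λ b → bit (not b)) (trans (and-++ t t) (∧-idem (and t)))) (map-++ bit t t)

polish : Sen → List ℕ → List ℕ
polish (atom i)   xs = 0 ∷ i ∷ xs
polish (neg a)    xs = 1 ∷ polish a xs
polish (conj a b) xs = 2 ∷ polish a (polish b xs)

polish-injective : ∀ a b {xs ys} → polish a xs ≡ polish b ys → a ≡ b × xs ≡ ys
polish-injective (atom i)   (atom j)   refl = refl , refl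
polish-injective (neg a)    (neg b)    eq with polish-injective a b (∷-injectiveʳ eq)
... | refl , xs≡ys = refl , xs≡ys
polish-injective (conj a b) (conj c d) eq with polish-injective a c (∷-injectiveʳ eq)
... | refl , rest with polish-injective b d rest
...   | refl , xs≡ys = refl , xs≡ys
polish-injective (atom _)   (neg _)    ()
polish-injective (atom _)   (conj _ _) ()
polish-injective (neg _)    (atom _)   ()
polish-injective (neg _)    (conj _ _) ()
polish-injective (conj _ _) (atom _)   ()
polish-injective (conj _ _) (neg _)    ()

++-cancel-≡-length : ∀ {A : Set} (p q : List A) {u v} → length p ≡ length q → p ++ u ≡ q ++ v → u ≡ v
++-cancel-≡-length []      []      _  eq = eq
++-cancel-≡-length (_ ∷ p) (_ ∷ q) ls eq = ++-cancel-≡-length p q (ℕ.suc-injective ls) (∷-injectiveʳ eq)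

key : ℕ → Sen → List ℕ
key k a = code (table k a) ++ polish a []

key-injective : ∀ k a b → key k a ≡ key k b → a ≡ b
key-injective k a b eq =
  proj₁ (polish-injective a b (++-cancel-≡-length (code (table k a)) (code (table k b)) (length-code-table k a b) eq))

_<⟨_⟩_ : Sen → ℕ → Sen → Set
a <⟨ k ⟩ b = key k a <ₗ key k b

key-suc : ∀ {k} a → atomBound a ≤ k →
          key (suc k) a ≡ [ flag (table k a) ] ++ map bit (table k a) ++ map bit (table k a) ++ polish a []
key-suc {k} a a≤k = begin
  code (table (suc k) a) ++ polish a []            ≡⟨ cong (λ t → code t ++ polish a []) (table-suc a a≤k) ⟩
  code (t ++ t) ++ polish a []                     ≡⟨ cong (_++ polish a []) (code-++-self t) ⟩
  flag t ∷ (map bit t ++ map bit t) ++ polish a []  ≡⟨ cong (flag t ∷_) (++-assoc (map bit t) _ _) ⟩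
  flag t ∷ map bit t ++ map bit t ++ polish a []    ∎
  where open ≡-Reasoning
        t = table k a

<⟨⟩-suc : ∀ {k} a b → atomBound a ≤ k → atomBound b ≤ k → (a <⟨ suc k ⟩ b) ⇔ (a <⟨ k ⟩ b)
<⟨⟩-suc {k} a b a≤k b≤k =
  subst₂ (λ x y → (x <ₗ y) ⇔ (a <⟨ k ⟩ b)) (sym (key-suc a a≤k)) (sym (key-suc b b≤k))
    (<ₗ-++-cong [ _ ] [ _ ] refl
      (<ₗ-++-duplicate (map bit (table k a)) (map bit (table k b))
        (ℕ.suc-injective (length-code-table k a b))))

<⟨⟩-stable : ∀ {k m} a b → atomBound a ≤ k → atomBound b ≤ k → k ≤′ m → (a <⟨ m ⟩ b) ⇔ (a <⟨ k ⟩ b)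
<⟨⟩-stable a b a≤k b≤k (≤′-reflexive refl) = ⇔.refl
<⟨⟩-stable a b a≤k b≤k (≤′-step k≤m) = ⇔.trans
  (<⟨⟩-suc a b (ℕ.≤-trans a≤k (ℕ.≤′⇒≤ k≤m)) (ℕ.≤-trans b≤k (ℕ.≤′⇒≤ k≤m)))
  (<⟨⟩-stable a b a≤k b≤k k≤m)

infix 4 _≺_
_≺_ : Rel Sen 0ℓ
a ≺ b = a <⟨ atomBound a ⊔ atomBound b ⟩ b

<⟨⟩⇔≺ : ∀ {k} a b → atomBound a ≤ k → atomBound b ≤ k → (a <⟨ k ⟩ b) ⇔ (a ≺ b)
<⟨⟩⇔≺ a b a≤k b≤k =
  <⟨⟩-stable a b (ℕ.m≤m⊔n _ _) (ℕ.m≤n⊔m _ _) (ℕ.≤⇒≤′ (ℕ.⊔-lub a≤k b≤k))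

private
  module Lexℕ = IsStrictTotalOrder (<-isStrictTotalOrder ℕ.<-isStrictTotalOrder)

≺-trans : ∀ {a b c} → a ≺ b → b ≺ c → a ≺ c
≺-trans {a} {b} {c} a≺b b≺c = Equivalence.to (<⟨⟩⇔≺ a c a≤k c≤k)
  (Lexℕ.trans (Equivalence.from (<⟨⟩⇔≺ a b a≤k b≤k) a≺b) (Equivalence.from (<⟨⟩⇔≺ b c b≤k c≤k) b≺c))
  where
  k = atomBound a ⊔ atomBound b ⊔ atomBound c
  a≤k = ℕ.m≤n⇒m≤n⊔o (atomBound c) (ℕ.m≤m⊔n (atomBound a) (atomBound b))
  b≤k = ℕ.m≤n⇒m≤n⊔o (atomBound c) (ℕ.m≤n⊔m (atomBound a) (atomBound b))
  c≤k = ℕ.m≤n⊔m (atomBound a ⊔ atomBound b) (atomBound c)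

≺-compare : ∀ a b → Tri (a ≺ b) (a ≡ b) (b ≺ a)
≺-compare a b = fromKeys (Lexℕ.compare (key k a) (key k b))
  where
  k = atomBound a ⊔ atomBound b
  b<a⇔b≺a : (b <⟨ k ⟩ a) ⇔ (b ≺ a)
  b<a⇔b≺a = <⟨⟩⇔≺ b a (ℕ.m≤n⊔m _ _) (ℕ.m≤m⊔n _ _)
  keys-≈ : a ≡ b → Pointwise _≡_ (key k a) (key k b)
  keys-≈ refl = ≡⇒Pointwise-≡ refl
  fromKeys : Tri (a ≺ b) (Pointwise _≡_ (key k a) (key k b)) (b <⟨ k ⟩ a) → Tri (a ≺ b) (a ≡ b) (b ≺ a)
  fromKeys (tri< a≺b a≉b b≮a) = tri< a≺b (a≉b ∘ keys-≈) (b≮a ∘ Equivalence.from b<a⇔b≺a)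
  fromKeys (tri≈ a⊀b a≈b b≮a) = tri≈ a⊀b (key-injective k a b (Pointwise-≡⇒≡ a≈b)) (b≮a ∘ Equivalence.from b<a⇔b≺a)
  fromKeys (tri> a⊀b a≉b b<a) = tri> a⊀b (a≉b ∘ keys-≈) (Equivalence.to b<a⇔b≺a b<a)

≺-isStrictTotalOrder : IsStrictTotalOrder _≡_ _≺_
≺-isStrictTotalOrder = isStrictTotalOrderᶜ record
  { isEquivalence = isEquivalence
  ; trans         = λ {a} {b} {c} → ≺-trans {a} {b} {c}
  ; compare       = ≺-compare
  }

<⟨⟩-of-code : ∀ k a b → code (table k a) <ₗ code (table k b) → a <⟨ k ⟩ b
<⟨⟩-of-code k a b lt = <ₗ-++⁺ (code (table k a)) (code (table k b)) (length-code-table k a b) (inj₁ lt)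

<⟨⟩⇒code-< : ∀ k a b → ¬ a ∼ b → atomBound a ≤ k → atomBound b ≤ k →
             a <⟨ k ⟩ b → code (table k a) <ₗ code (table k b)
<⟨⟩⇒code-< k a b a≁b a≤k b≤k lt
  with <ₗ-++⁻ (code (table k a)) (code (table k b)) (length-code-table k a b) lt
... | inj₁ codes<     = codes<
... | inj₂ (codes≡ , _) = ⊥-elim (a≁b (table-injective a b a≤k b≤k (code-injective codes≡)))

≺-regular : Regular _≺_
≺-regular a b a≁b a≺b a′ b′ a′∼a b′∼b = Equivalence.to (<⟨⟩⇔≺ a′ b′ a′≤k b′≤k)
  (<⟨⟩-of-code k a′ b′
    (subst₂ _<ₗ_ (cong code (sym (table-cong k a′ a a′∼a))) (cong code (sym (table-cong k b′ b b′∼b)))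
      (<⟨⟩⇒code-< k a b a≁b a≤k b≤k (Equivalence.from (<⟨⟩⇔≺ a b a≤k b≤k) a≺b))))
  where
  k = (atomBound a ⊔ atomBound b) ⊔ (atomBound a′ ⊔ atomBound b′)
  a≤k = ℕ.m≤n⇒m≤n⊔o _ (ℕ.m≤m⊔n (atomBound a) (atomBound b))
  b≤k = ℕ.m≤n⇒m≤n⊔o _ (ℕ.m≤n⊔m (atomBound a) (atomBound b))
  a′≤k = ℕ.m≤n⇒m≤o⊔n (atomBound a ⊔ atomBound b) (ℕ.m≤m⊔n (atomBound a′) (atomBound b′))
  b′≤k = ℕ.m≤n⇒m≤o⊔n (atomBound a ⊔ atomBound b) (ℕ.m≤n⊔m (atomBound a′) (atomBound b′))

p₀ falsum verum : Sen
p₀     = atom 0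
falsum = conj p₀ (neg p₀)
verum  = neg falsum

≺-not-NegDecreasing : ¬ NegDecreasing _≺_
≺-not-NegDecreasing negDecreasing =
  Lexℕ.asym (proj₁ (negDecreasing verum p₀ verum≁p₀) verum≺p₀) neg-verum≺neg-p₀
  where
  verum≁p₀ : ¬ verum ∼ p₀
  verum≁p₀ equivalent with equivalent (λ _ → false)
  ... | ()
  verum≺p₀ : verum ≺ p₀
  verum≺p₀ = this z<s
  neg-verum≺neg-p₀ : neg verum ≺ neg p₀
  neg-verum≺neg-p₀ = next refl (this z<s)

proposition2p45 : Σ Sen λ α → Σ Sen λ β → Σ Sen λ γ → Σ Assignment λ M →
    Σ (Rel Sen 0ℓ) λ _<_ → Σ (IsStrictTotalOrder _≡_ _<_) λ sto →
    Regular _<_ × ¬ NegDecreasing _<_ ×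
    ¬ (M , minOf sto ⊨s ((emb α ∘s bar (emb β) (emb γ)) ⇔s bar (emb α ∘s emb β) (emb α ∘s emb γ)))
proposition2p45 =
  verum , falsum , p₀ , (λ _ → false) , _≺_ , ≺-isStrictTotalOrder , ≺-regular , ≺-not-NegDecreasing , λ ()
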